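{- Let $q>4$ and $q'\in\{2q+2,2q+3\}$. Let $S$ be an $\mathcal{OS}_q(2)$ of maximal period $m$ (i.e.\ $m=q(q-1)/2$ for $q$ odd, $m=q(q-2)/2$ for $q$ even) whose ring sequence $[s_0,\ldots,s_{m-1}]$ has the form $[0,1,q-1,0,\ldots]$. Let $t_i=(-1)^{i+m-1}s'_i$ if $s'_i\neq0$ and $t_i=(-1)^{i+m-1}q$ (in $\mathbb{Z}_{q'}$) if $s'_i=0$, and let $U$ be the sequence over $\mathbb{Z}_{q'}$ with ring sequence $[s'_0,\ldots,s'_{m-1},-s'_0,\ldots,-s'_{m-1},t_0,\ldots,t_{m-1},-t_0,\ldots,-t_{m-1}]$. Let $U'$ be obtained from $U$ by replacing half of the zeros in its ring sequence by $q+1$ and the other half by $q'-q-1$, in such a way that the first two zeros (at positions $0$ and $3$) are replaced by $q+1$; so the ring sequence of $U'$ has the form $[q+1,1,q-1,q+1,\ldots]$. Let $U^{**}$ be obtained by deleting the first three terms of the ring sequence of $U'$. Then $U^{**}$ is a good $\mathcal{SOS}_{q'}(2)$ of period $2q(q-1)-3$ ($q$ odd) or $2q(q-2)-3$ ($q$ even), and $w_{q'}(U^{**})$ is coprime to $q'$.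
   Context: For $x\in\mathbb{Z}_q$, $x'$ denotes the residue class in $\mathbb{Z}_{q'}$ of the unique integer in $\{0,\ldots,q-1\}$ representing $x$. A periodic sequence is described by its ring sequence (one period). Write $\mathbf{s}_n(i)=(s_i,\ldots,s_{i+n-1})$; for an $n$-tuple $\mathbf{u}$, $\mathbf{u}^R$ is its reverse and $-\mathbf{u}$ its entrywise negative. An $n$-window sequence of period $m$ is one where $\mathbf{s}_n(i)=\mathbf{s}_n(j)$ implies $i\equiv j\pmod m$. An $\mathcal{OS}_q(n)$ is an $n$-window sequence over $\mathbb{Z}_q$ with $\mathbf{s}_n(i)\neq\mathbf{s}_n(j)^R$ for all $i,j$; an $\mathcal{SOS}_q(n)$ is an $\mathcal{OS}_q(n)$ with additionally $\mathbf{s}_n(i)\neq-\mathbf{s}_n(j)^R$ for all $i,j$. It is good if every run of consecutive $0$s has length at most $n-2$. The weight $w(U)$ of a sequence over $\mathbb{Z}_{q'}$ is the sum of the terms of its ring sequence, each treated as an integer in $[0,q'-1]$; $w_{q'}(U)=w(U)\bmod q'$. -}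

module Defs where

open import Data.Nat using (ℕ; zero; suc; _+_; _*_; _∸_; _<_)
open import Data.Nat.DivMod using (_mod_; _%_)
open import Data.Bool using (Bool; true; false; if_then_else_; _∧_)
import Data.Bool as B
open import Data.List using (List; []; _∷_; map; reverse; upTo; applyUpTo; length; lookup; _++_)
open import Data.Nat.ListAction using (sum)
open import Data.List.Relation.Unary.All using (All)
open import Data.Product using (∃; _×_)
open import Data.Sum using (_⊎_)
open import Relation.Binary.PropositionalEquality using (_≡_; _≢_)
open import Relation.Nullary using (¬_)
open import Relation.Nullary.Decidable using (⌊_⌋)
open import Data.Nat using (_≟_)

-- A periodic sequence is represented by its ring sequence (one period),
-- a list of naturals.  Terms of a sequence over ℤ_q are represented by their
-- canonical representatives in {0,…,q-1}.

term : List ℕ → ℕ → ℕ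
term []       i = 0
term (x ∷ xs) i = lookup (x ∷ xs) (i mod suc (length xs))

window : ℕ → List ℕ → ℕ → List ℕ
window n r i = map (λ k → term r (i + k)) (upTo n)

_≡_[mod_] : ℕ → ℕ → ℕ → Set
i ≡ j [mod m ] = ∃ λ k → (i ≡ j + k * m) ⊎ (j ≡ i + k * m)

neg : ℕ → ℕ → ℕ
neg q zero    = zero
neg q (suc x) = q ∸ suc x

Over : ℕ → List ℕ → Set
Over q r = All (_< q) r

WindowSeq : ℕ → List ℕ → Set
WindowSeq n r = ∀ i j → window n r i ≡ window n r j → i ≡ j [mod length r ]

OS : ℕ → ℕ → List ℕ → Set
OS q n r = Over q r × WindowSeq n r × (∀ i j → window n r i ≢ reverse (window n r j))

SOS : ℕ → ℕ → List ℕ → Set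
SOS q n r = OS q n r × (∀ i j → window n r i ≢ map (neg q) (reverse (window n r j)))

-- good: every run of consecutive 0s has length at most n-2, i.e. there is
-- no run of n-1 consecutive zeros
Good : ℕ → List ℕ → Set
Good n r = ∀ i → ¬ All (_≡ 0) (window (n ∸ 1) r i)

weight : List ℕ → ℕ
weight r = sum r

_%'_ : ℕ → ℕ → ℕ
a %' zero  = a
a %' suc n = a % suc n

weightMod : ℕ → List ℕ → ℕ
weightMod q' r = weight r %' q'

isEven : ℕ → Bool
isEven zero          = true
isEven (suc zero)    = false
isEven (suc (suc n)) = isEven n

signed : ℕ → ℕ → ℕ → ℕ
signed q' e x = if isEven e then x else neg q' x

-- The lift x ↦ x' from ℤ_q to ℤ_{q'} is the identity on canonical
-- representatives (valid since q < q').

tTerm : ℕ → ℕ → ℕ → List ℕ → ℕ → ℕ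
tTerm q q' m s i with term s i
... | zero  = signed q' (i + m ∸ 1) q
... | suc x = signed q' (i + m ∸ 1) (suc x)

Useq : ℕ → ℕ → List ℕ → List ℕ
Useq q q' s =
  s ++ map (neg q') s ++ tl ++ map (neg q') tl
  where
  tl = applyUpTo (tTerm q q' (length s) s) (length s)

isZero : ℕ → Bool
isZero n = ⌊ n ≟ 0 ⌋

replaceZeros : ℕ → ℕ → (ℕ → Bool) → List ℕ → List ℕ
replaceZeros q q' c u =
  applyUpTo (λ i → if isZero (term u i) then (if c i then q + 1 else q' ∸ q ∸ 1) else term u i) (length u)

countBool : List Bool → ℕ
countBool []          = 0
countBool (true ∷ bs)  = suc (countBool bs)
countBool (false ∷ bs) = countBool bs

countChoice : (ℕ → Bool) → Bool → List ℕ → ℕ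
countChoice c b u =
  countBool (map (λ i → isZero (term u i) ∧ ⌊ c i B.≟ b ⌋) (upTo (length u)))

ValidChoice : (ℕ → Bool) → List ℕ → Set
ValidChoice c u = countChoice c true u ≡ countChoice c false u × c 0 ≡ true × c 3 ≡ true

-- Every term of U′ is ±x′ for a term x of S (a zero of S being lifted to ±q in the t-half), or a
-- replaced zero q + 1 or q′ − q − 1. As q′ ≥ 2q + 2 these values lie in the three disjoint bands
-- [1, q], (q, q′ − q) and [q′ − q, q′), so a term of U′ determines its band and the term x of S it
-- lies over, and x is unchanged by negation. Hence two consecutive terms of U′ determine a window of
-- S, and so its index, while their bands determine which of the quarters s′, −s′, t, −t they are
-- in: U′ is a zero-free SOS_{q′}(2). Since U′ has equal terms at positions 3 and 0, the windows of
-- U** are windows of U′ at distinct positions, so U** is one as well. For the weight, x and −x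
-- cancel modulo q′, and the zeros are shared equally by q + 1 and q′ − q − 1, whose sum is q′. So q′
-- divides w(U′) = (q + 1) + 1 + (q − 1) + w(U**), i.e. w(U**) ≡ −(2q + 1), which is 1 or 2 mod q′.

{-# OPTIONS --safe #-}
module Submission where

open import Defs
open import Data.Bool using (Bool; true; false; if_then_else_; not; _∧_)
import Data.Bool as Bool
open import Data.Fin using (Fin; toℕ)
import Data.Fin as Fin
open import Data.Fin.Properties using (toℕ-fromℕ<)
open import Data.List using (List; []; _∷_; map; reverse; upTo; applyUpTo; length; lookup; _++_; drop)
open import Data.List.Properties
  using (map-cong; map-∘; map-upTo; reverse-map; length-map; length-++; length-drop; length-applyUpTo;
         ∷-injectiveˡ; ∷-injectiveʳ)
open import Data.List.Membership.Propositional.Properties using (∈-lookup)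
import Data.List.Relation.Unary.All as All
open All using (All; []; _∷_)
open import Data.List.Relation.Unary.All.Properties using (drop⁺; applyUpTo⁺₁)
open import Data.Nat
open import Data.Nat.Properties
open import Data.Nat.DivMod
open import Data.Nat.Divisibility
  using (_∣_; divides; _∣0; ∣-refl; ∣-trans; ∣m∣n⇒∣m+n; ∣m+n∣m⇒∣n; m∣m*n; ∣1⇒≡1)
open import Data.Nat.Coprimality using (Coprime; 1-coprimeTo)
open import Data.Nat.ListAction using (sum)
open import Data.Nat.ListAction.Properties using (sum-++)
open import Data.Nat.Tactic.RingSolver using (solve-∀)
open import Relation.Nullary.Decidable using (⌊_⌋)
open import Data.Product using (Σ; ∃; ∃₂; _×_; _,_; proj₁; proj₂)
open import Data.Sum using (_⊎_; inj₁; inj₂)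
open import Function using (_∘_)
open import Relation.Binary.PropositionalEquality
open import Relation.Nullary using (contradiction; yes; no)

-- Lists indexed by naturals

nth : List ℕ → ℕ → ℕ
nth []       _       = 0
nth (x ∷ xs) zero    = x
nth (x ∷ xs) (suc k) = nth xs k

nth-++ˡ : ∀ xs ys {k} → k < length xs → nth (xs ++ ys) k ≡ nth xs k
nth-++ˡ (x ∷ xs) ys {zero}  _         = refl
nth-++ˡ (x ∷ xs) ys {suc k} (s≤s k<n) = nth-++ˡ xs ys k<n

nth-++ʳ : ∀ xs ys k → nth (xs ++ ys) (length xs + k) ≡ nth ys k
nth-++ʳ []       ys k = refl
nth-++ʳ (x ∷ xs) ys k = nth-++ʳ xs ys k

nth-map : ∀ f xs {k} → k < length xs → nth (map f xs) k ≡ f (nth xs k)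
nth-map f (x ∷ xs) {zero}  _         = refl
nth-map f (x ∷ xs) {suc k} (s≤s k<n) = nth-map f xs k<n

nth-applyUpTo : ∀ f n {k} → k < n → nth (applyUpTo f n) k ≡ f k
nth-applyUpTo f (suc n) {zero}  _         = refl
nth-applyUpTo f (suc n) {suc k} (s≤s k<n) = nth-applyUpTo (f ∘ suc) n k<n

nth-drop : ∀ d xs k → nth (drop d xs) k ≡ nth xs (d + k)
nth-drop zero    xs       k = refl
nth-drop (suc d) []       k = refl
nth-drop (suc d) (x ∷ xs) k = nth-drop d xs k

nth-++ʳ′ : ∀ xs ys {n} k → length xs ≡ n → nth (xs ++ ys) (n + k) ≡ nth ys k
nth-++ʳ′ xs ys k refl = nth-++ʳ xs ys k

All-nth : ∀ {P : ℕ → Set} {xs k} → All P xs → k < length xs → P (nth xs k)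
All-nth {k = zero}  (px ∷ _)   _         = px
All-nth {k = suc k} (_  ∷ pxs) (s≤s k<n) = All-nth pxs k<n

applyUpTo-nth : ∀ xs → applyUpTo (nth xs) (length xs) ≡ xs
applyUpTo-nth []       = refl
applyUpTo-nth (x ∷ xs) = cong (x ∷_) (applyUpTo-nth xs)

applyUpTo-cong-< : ∀ {f g : ℕ → ℕ} n → (∀ {i} → i < n → f i ≡ g i) →
                   applyUpTo f n ≡ applyUpTo g n
applyUpTo-cong-< zero    f≡g = refl
applyUpTo-cong-< (suc n) f≡g = cong₂ _∷_ (f≡g z<s) (applyUpTo-cong-< n (f≡g ∘ s<s))

lookup≡nth : ∀ xs (k : Fin (length xs)) → lookup xs k ≡ nth xs (toℕ k)
lookup≡nth (x ∷ xs) Fin.zero    = refl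
lookup≡nth (x ∷ xs) (Fin.suc k) = lookup≡nth xs k

term≡nth-% : ∀ xs i .{{_ : NonZero (length xs)}} → term xs i ≡ nth xs (i % length xs)
term≡nth-% (x ∷ xs) i =
  trans (lookup≡nth (x ∷ xs) (i mod length (x ∷ xs)))
        (cong (nth (x ∷ xs)) (toℕ-fromℕ< (m%n<n i (length (x ∷ xs)))))

term≡nth : ∀ xs {i} → i < length xs → term xs i ≡ nth xs i
term≡nth (x ∷ xs) {i} i<n = trans (term≡nth-% (x ∷ xs) i) (cong (nth (x ∷ xs)) (m<n⇒m%n≡m i<n))

term-applyUpTo : ∀ f n i .{{_ : NonZero n}} → term (applyUpTo f n) i ≡ f (i % n)
term-applyUpTo f (suc n) i = begin
  term (applyUpTo f (suc n)) i                    ≡⟨ term≡nth-% (applyUpTo f (suc n)) i ⟩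
  nth (applyUpTo f (suc n)) (i % length (applyUpTo f (suc n)))
    ≡⟨ cong (λ l → nth (applyUpTo f (suc n)) (i % suc l)) (length-applyUpTo (f ∘ suc) n) ⟩
  nth (applyUpTo f (suc n)) (i % suc n)           ≡⟨ nth-applyUpTo f (suc n) (m%n<n i (suc n)) ⟩
  f (i % suc n)                                   ∎
  where open ≡-Reasoning

applyUpTo-term : ∀ xs → applyUpTo (term xs) (length xs) ≡ xs
applyUpTo-term xs = trans (applyUpTo-cong-< (length xs) (term≡nth xs)) (applyUpTo-nth xs)

All-term : ∀ {P : ℕ → Set} {xs} → All P xs → .{{_ : NonZero (length xs)}} → ∀ i → P (term xs i)
All-term {xs = x ∷ xs} pxs i = All.lookup pxs (∈-lookup (i mod length (x ∷ xs)))

-- Windows of periodic sequences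

quotient-shift : ∀ {i j} n .{{_ : NonZero n}} → i % n ≡ j % n → j / n ≤ i / n →
                 i ≡ j + (i / n ∸ j / n) * n
quotient-shift {i} {j} n i%n≡j%n j/n≤i/n = begin
  i                                            ≡⟨ m≡m%n+[m/n]*n i n ⟩
  i % n + (i / n) * n                          ≡⟨ cong₂ (λ r k → r + k * n) i%n≡j%n
                                                         (sym (m∸n+n≡m j/n≤i/n)) ⟩
  j % n + (d + j / n) * n                      ≡⟨ cong (j % n +_) (*-distribʳ-+ n d (j / n)) ⟩
  j % n + (d * n + (j / n) * n)                ≡⟨ cong (j % n +_) (+-comm (d * n) _) ⟩
  j % n + ((j / n) * n + d * n)                ≡⟨ sym (+-assoc (j % n) _ _) ⟩
  j % n + (j / n) * n + d * n                  ≡⟨ cong (_+ d * n) (sym (m≡m%n+[m/n]*n j n)) ⟩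
  j + d * n                                    ∎
  where
  open ≡-Reasoning
  d : ℕ
  d = i / n ∸ j / n

%≡⇒≡[mod] : ∀ {i j} n .{{_ : NonZero n}} → i % n ≡ j % n → i ≡ j [mod n ]
%≡⇒≡[mod] {i} {j} n i%n≡j%n with ≤-total (j / n) (i / n)
... | inj₁ j/n≤i/n = i / n ∸ j / n , inj₁ (quotient-shift n i%n≡j%n j/n≤i/n)
... | inj₂ i/n≤j/n = j / n ∸ i / n , inj₂ (quotient-shift n (sym i%n≡j%n) i/n≤j/n)

≡[mod]⇒≡ : ∀ {i j n} → i < n → j < n → i ≡ j [mod n ] → i ≡ j
≡[mod]⇒≡ _ _ (zero , inj₁ i≡j+0) = trans i≡j+0 (+-identityʳ _)
≡[mod]⇒≡ _ _ (zero , inj₂ j≡i+0) = sym (trans j≡i+0 (+-identityʳ _))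
≡[mod]⇒≡ {j = j} {n} i<n _ (suc k , inj₁ i≡j+n+kn) =
  contradiction (subst (n ≤_) (sym i≡j+n+kn) (≤-trans (m≤m+n n (k * n)) (m≤n+m _ j))) (<⇒≱ i<n)
≡[mod]⇒≡ {i = i} {n = n} _ j<n (suc k , inj₂ j≡i+n+kn) =
  contradiction (subst (n ≤_) (sym j≡i+n+kn) (≤-trans (m≤m+n n (k * n)) (m≤n+m _ i))) (<⇒≱ j<n)

Avoids : ℕ → (List ℕ → List ℕ) → List ℕ → Set
Avoids n g r = ∀ i j → window n r i ≢ g (window n r j)

windowSeq⇒injective-< : ∀ {n r k k'} → WindowSeq n r → k < length r → k' < length r →
                        window n r k ≡ window n r k' → k ≡ k'
windowSeq⇒injective-< ws k<N k'<N e = ≡[mod]⇒≡ k<N k'<N (ws _ _ e)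

module _ (r : List ℕ) .{{_ : NonZero (length r)}} where
  private
    N : ℕ
    N = length r

  term-cong-% : ∀ {i j} → i % N ≡ j % N → term r i ≡ term r j
  term-cong-% {i} {j} e = trans (term≡nth-% r i) (trans (cong (nth r) e) (sym (term≡nth-% r j)))

  window-% : ∀ n i → window n r i ≡ window n r (i % N)
  window-% n i = map-cong (λ k → term-cong-% (shift k)) (upTo n)
    where
    open ≡-Reasoning
    shift : ∀ k → (i + k) % N ≡ (i % N + k) % N
    shift k = begin
      (i + k) % N                ≡⟨ %-distribˡ-+ i k N ⟩
      (i % N + k % N) % N        ≡⟨ cong (λ a → (a + k % N) % N) (sym (m%n%n≡m%n i N)) ⟩
      (i % N % N + k % N) % N    ≡⟨ sym (%-distribˡ-+ (i % N) k N) ⟩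
      (i % N + k) % N            ∎

  injective-<⇒windowSeq : ∀ {n} → (∀ {k k'} → k < N → k' < N → window n r k ≡ window n r k' → k ≡ k') →
                          WindowSeq n r
  injective-<⇒windowSeq inj i j e =
    %≡⇒≡[mod] N (inj (m%n<n i N) (m%n<n j N) (trans (sym (window-% _ i)) (trans e (window-% _ j))))

  avoids-<⇒Avoids : ∀ {n} g → (∀ {k k'} → k < N → k' < N → window n r k ≢ g (window n r k')) →
                    Avoids n g r
  avoids-<⇒Avoids g avoid i j e =
    avoid (m%n<n i N) (m%n<n j N) (trans (sym (window-% _ i)) (trans e (cong g (window-% _ j))))

module _ (r : List ℕ) {d} (d<N : d < length r) (wrap : term r d ≡ term r 0) where
  private
    N : ℕ
    N = length r
    V : List ℕ
    V = drop d r
    n : ℕ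
    n = length V

    d+n≡N : d + n ≡ N
    d+n≡N = trans (cong (d +_) (length-drop d r)) (m+[n∸m]≡n (<⇒≤ d<N))

    instance
      N-nonZero : NonZero N
      N-nonZero = >-nonZero (≤-trans (s≤s z≤n) d<N)
      n-nonZero : NonZero n
      n-nonZero = >-nonZero (subst (0 <_) (sym (length-drop d r)) (m<n⇒0<n∸m d<N))

    d+k<N : ∀ {k} → k < n → d + k < N
    d+k<N k<n = subst (d + _ <_) d+n≡N (+-monoʳ-< d k<n)

  -- The hypothesis wrap makes the last window of drop d r, which wraps around to r[d], a window of r.
  term-drop : ∀ {k} → k ≤ n → term V k ≡ term r (d + k)
  term-drop {k} k≤n with m≤n⇒m<n∨m≡n k≤n
  ... | inj₁ k<n = begin
    term V k        ≡⟨ term≡nth V k<n ⟩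
    nth V k         ≡⟨ nth-drop d r k ⟩
    nth r (d + k)   ≡⟨ sym (term≡nth r (d+k<N k<n)) ⟩
    term r (d + k)  ∎
    where open ≡-Reasoning
  ... | inj₂ refl = begin
    term V n        ≡⟨ term-cong-% V (trans (n%n≡0 n) (sym (m<n⇒m%n≡m (>-nonZero⁻¹ n)))) ⟩
    term V 0        ≡⟨ term≡nth V (>-nonZero⁻¹ n) ⟩
    nth V 0         ≡⟨ nth-drop d r 0 ⟩
    nth r (d + 0)   ≡⟨ cong (nth r) (+-identityʳ d) ⟩
    nth r d         ≡⟨ sym (term≡nth r d<N) ⟩
    term r d        ≡⟨ wrap ⟩
    term r 0        ≡⟨ term-cong-% r (trans (m<n⇒m%n≡m (>-nonZero⁻¹ N)) (sym (n%n≡0 N))) ⟩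
    term r N        ≡⟨ cong (term r) (sym d+n≡N) ⟩
    term r (d + n)  ∎
    where open ≡-Reasoning

  window-drop : ∀ {k} → k < n → window 2 V k ≡ window 2 r (d + k)
  window-drop {k} k<n = cong₂ (λ a b → a ∷ b ∷ [])
    (trans (term-drop (subst (_≤ n) (sym (+-identityʳ k)) (<⇒≤ k<n)))
           (cong (term r) (sym (+-assoc d k 0))))
    (trans (term-drop (subst (_≤ n) (+-comm 1 k) k<n)) (cong (term r) (sym (+-assoc d k 1))))

  windowSeq-drop : WindowSeq 2 r → WindowSeq 2 V
  windowSeq-drop ws = injective-<⇒windowSeq V {2} λ k<n k'<n e →
    +-cancelˡ-≡ d _ _ (windowSeq⇒injective-< {r = r} ws (d+k<N k<n) (d+k<N k'<n)
      (trans (sym (window-drop k<n)) (trans e (window-drop k'<n))))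

  avoids-drop : ∀ g → Avoids 2 g r → Avoids 2 g V
  avoids-drop g avoid = avoids-<⇒Avoids V {2} g λ {k} {k'} k<n k'<n e →
    avoid (d + k) (d + k') (trans (sym (window-drop k<n)) (trans e (cong g (window-drop k'<n))))

  SOS-drop : ∀ {Q} → SOS Q 2 r → SOS Q 2 V
  SOS-drop {Q} ((over , ws , noReversal) , noNegReversal) =
      (drop⁺ d over , windowSeq-drop ws , avoids-drop reverse noReversal)
    , avoids-drop (map (neg Q) ∘ reverse) noNegReversal

All-positive⇒Good : ∀ {r} → All (0 <_) r → .{{_ : NonZero (length r)}} → Good 2 r
All-positive⇒Good positive i (term≡0 ∷ []) = <⇒≢ (All-term positive (i + 0)) (sym term≡0)

-- Replacing zeros, weights and residues

fill : (ℕ → ℕ) → (ℕ → Bool) → ℕ → ℕ → ℕ → ℕ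
fill h c a b i = if isZero (h i) then (if c i then a else b) else h i

zeroChosen : (ℕ → ℕ) → (ℕ → Bool) → Bool → ℕ → Bool
zeroChosen h c b i = isZero (h i) ∧ ⌊ c i Bool.≟ b ⌋

zerosChosen : (ℕ → ℕ) → (ℕ → Bool) → Bool → ℕ → ℕ
zerosChosen h c b n = countBool (applyUpTo (zeroChosen h c b) n)

countChoice≡zerosChosen : ∀ c b u → countChoice c b u ≡ zerosChosen (term u) c b (length u)
countChoice≡zerosChosen c b u = cong countBool (map-upTo _ (length u))

indicator : Bool → ℕ
indicator true  = 1
indicator false = 0

countBool-∷ : ∀ b bs → countBool (b ∷ bs) ≡ indicator b + countBool bs
countBool-∷ true  bs = refl
countBool-∷ false bs = refl

fill-pointwise : ∀ h c a b i →
  fill h c a b i ≡ h i + (a * indicator (zeroChosen h c true i) + b * indicator (zeroChosen h c false i))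
fill-pointwise h c a b i with h i | c i
... | zero  | true  = sym (trans (cong₂ _+_ (*-identityʳ a) (*-zeroʳ b)) (+-identityʳ a))
... | zero  | false = sym (cong₂ _+_ (*-zeroʳ a) (*-identityʳ b))
... | suc x | _     = sym (trans (cong (suc x +_) (cong₂ _+_ (*-zeroʳ a) (*-zeroʳ b))) (+-identityʳ (suc x)))

sum-fill : ∀ h c a b n → sum (applyUpTo (fill h c a b) n) ≡
           sum (applyUpTo h n) + (a * zerosChosen h c true n + b * zerosChosen h c false n)
sum-fill h c a b zero    = sym (cong₂ _+_ (*-zeroʳ a) (*-zeroʳ b))
sum-fill h c a b (suc n) = begin
  fill h c a b 0 + sum (applyUpTo (fill h c a b ∘ suc) n)
    ≡⟨ cong₂ _+_ (fill-pointwise h c a b 0) (sum-fill (h ∘ suc) (c ∘ suc) a b n) ⟩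
  h 0 + (a * t₀ + b * f₀) + (sum (applyUpTo (h ∘ suc) n) + (a * t + b * f))
    ≡⟨ regroup (h 0) (sum (applyUpTo (h ∘ suc) n)) a b t₀ f₀ t f ⟩
  sum (applyUpTo h (suc n)) + (a * (t₀ + t) + b * (f₀ + f))
    ≡⟨ sym (cong₂ (λ x y → sum (applyUpTo h (suc n)) + (a * x + b * y))
                  (countBool-∷ (zeroChosen h c true 0) _) (countBool-∷ (zeroChosen h c false 0) _)) ⟩
  sum (applyUpTo h (suc n)) + (a * zerosChosen h c true (suc n) + b * zerosChosen h c false (suc n))
    ∎
  where
  open ≡-Reasoning
  t₀ f₀ t f : ℕ
  t₀ = indicator (zeroChosen h c true 0)
  f₀ = indicator (zeroChosen h c false 0)
  t  = zerosChosen (h ∘ suc) (c ∘ suc) true n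
  f  = zerosChosen (h ∘ suc) (c ∘ suc) false n
  regroup : ∀ x S a b t₀ f₀ t f →
            x + (a * t₀ + b * f₀) + (S + (a * t + b * f)) ≡ x + S + (a * (t₀ + t) + b * (f₀ + f))
  regroup = solve-∀

∣sum+sum-neg : ∀ {Q} xs → All (_≤ Q) xs → Q ∣ sum xs + sum (map (neg Q) xs)
∣sum+sum-neg {Q} []           []           = Q ∣0
∣sum+sum-neg {Q} (zero ∷ xs)  (_ ∷ xs≤Q)   = ∣sum+sum-neg xs xs≤Q
∣sum+sum-neg {Q} (suc x ∷ xs) (x<Q ∷ xs≤Q) =
  subst (Q ∣_) (trans (cong (_+ (sum xs + S′)) (sym (m∸n+n≡m x<Q))) (regroup (suc x) (Q ∸ suc x) (sum xs) S′))
        (∣m∣n⇒∣m+n ∣-refl (∣sum+sum-neg xs xs≤Q))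
  where
  S′ : ℕ
  S′ = sum (map (neg Q) xs)
  regroup : ∀ a b S S′ → b + a + (S + S′) ≡ a + S + (b + S′)
  regroup = solve-∀

%-complement : ∀ {S a r Q} .{{_ : NonZero Q}} → Q ∣ S + a → a + r ≡ Q → S % Q ≡ r % Q
%-complement {S} {a} {r} {Q} (divides k S+a≡kQ) a+r≡Q = begin
  S % Q               ≡⟨ sym ([m+n]%n≡m%n S Q) ⟩
  (S + Q) % Q         ≡⟨ cong (λ x → (S + x) % Q) (sym a+r≡Q) ⟩
  (S + (a + r)) % Q   ≡⟨ cong (_% Q) (sym (+-assoc S a r)) ⟩
  (S + a + r) % Q     ≡⟨ cong (λ x → (x + r) % Q) S+a≡kQ ⟩
  (k * Q + r) % Q     ≡⟨ cong (_% Q) (+-comm (k * Q) r) ⟩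
  (r + k * Q) % Q     ≡⟨ [m+kn]%n≡m%n r k Q ⟩
  r % Q               ∎
  where open ≡-Reasoning

2-coprime-odd : ∀ k → Coprime 2 (2 * k + 1)
2-coprime-odd k (d∣2 , d∣2k+1) = ∣1⇒≡1 (∣m+n∣m⇒∣n d∣2k+1 (∣-trans d∣2 (m∣m*n k)))

%'≡% : ∀ a Q .{{_ : NonZero Q}} → a %' Q ≡ a % Q
%'≡% a (suc Q) = refl

coprime-residue : ∀ {q Q S} → (Q ≡ 2 * q + 2 ⊎ Q ≡ 2 * q + 3) → Q ∣ S + (2 * q + 1) →
                  Coprime (S %' Q) Q
coprime-residue {q} {S = S} (inj₁ refl) Q∣ =
  subst (λ r → Coprime r (2 * q + 2)) (sym S%Q≡1) (1-coprimeTo _)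
  where
  instance
    Q-nonZero : NonZero (2 * q + 2)
    Q-nonZero = >-nonZero (<-≤-trans z<s (m≤n+m 2 (2 * q)))
  S%Q≡1 : S %' (2 * q + 2) ≡ 1
  S%Q≡1 = trans (%'≡% S _) (trans (%-complement Q∣ (+-assoc (2 * q) 1 1)) (m<n⇒m%n≡m (m≤n+m 2 (2 * q))))
coprime-residue {q} {S = S} (inj₂ refl) Q∣ =
  subst (λ r → Coprime r (2 * q + 3)) (sym S%Q≡2) 2-coprime-Q
  where
  instance
    Q-nonZero : NonZero (2 * q + 3)
    Q-nonZero = >-nonZero (<-≤-trans z<s (m≤n+m 3 (2 * q)))
  S%Q≡2 : S %' (2 * q + 3) ≡ 2
  S%Q≡2 = trans (%'≡% S _) (trans (%-complement Q∣ (+-assoc (2 * q) 1 2)) (m<n⇒m%n≡m (m≤n+m 3 (2 * q))))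
  odd : ∀ q → 2 * suc q + 1 ≡ 2 * q + 3
  odd = solve-∀
  2-coprime-Q : Coprime 2 (2 * q + 3)
  2-coprime-Q = subst (Coprime 2) (odd q) (2-coprime-odd (suc q))

sum≡first-three+sum-drop : ∀ xs → 3 ≤ length xs →
                           sum xs ≡ nth xs 0 + (nth xs 1 + (nth xs 2 + sum (drop 3 xs)))
sum≡first-three+sum-drop (a ∷ b ∷ c ∷ xs) _ = refl
sum≡first-three+sum-drop (a ∷ b ∷ []) (s≤s (s≤s ()))
sum≡first-three+sum-drop (a ∷ []) (s≤s ())

-- Reading off a term of U′

neg≡∸ : ∀ {Q v} → 0 < v → neg Q v ≡ Q ∸ v
neg≡∸ {v = suc v} _ = refl

∸-flip-< : ∀ {Q q v} → q ≤ Q → v < Q ∸ q → q < Q ∸ v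
∸-flip-< {Q} {q} {v} q≤Q v<Q∸q =
  subst (_< Q ∸ v) (m∸[m∸n]≡n q≤Q) (∸-monoʳ-< v<Q∸q (m∸n≤m Q q))

gap-from : ∀ {q Q} → (Q ≡ 2 * q + 2 ⊎ Q ≡ 2 * q + 3) → suc q < Q ∸ q
gap-from {q} {Q} Q≡ = m+n≤o⇒m≤o∸n (suc (suc q)) (subst (_≤ Q) (rearrange q) (2q+2≤Q Q≡))
  where
  2q+2≤Q : (Q ≡ 2 * q + 2 ⊎ Q ≡ 2 * q + 3) → 2 * q + 2 ≤ Q
  2q+2≤Q (inj₁ refl) = ≤-refl
  2q+2≤Q (inj₂ refl) = +-monoʳ-≤ (2 * q) (n≤1+n 2)
  rearrange : ∀ q → 2 * q + 2 ≡ suc (suc q) + q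
  rearrange = solve-∀

data Band : Set where
  low middle high : Band

flipBand : Band → Band
flipBand low    = high
flipBand middle = middle
flipBand high   = low

module Decoding (q Q : ℕ) (gap : suc q < Q ∸ q) where

  q<Q∸q : q < Q ∸ q
  q<Q∸q = ≤-trans (n≤1+n (suc q)) gap

  q<Q : q < Q
  q<Q = <-≤-trans q<Q∸q (m∸n≤m Q q)

  q≤Q : q ≤ Q
  q≤Q = <⇒≤ q<Q

  lift : ℕ → ℕ
  lift zero    = q
  lift (suc x) = suc x

  lift-≤ : ∀ {x} → x < q → lift x ≤ q
  lift-≤ {zero}  _   = ≤-refl
  lift-≤ {suc x} x<q = <⇒≤ x<q

  lift-positive : ∀ {x} → x < q → 0 < lift x
  lift-positive {zero}  0<q = 0<q
  lift-positive {suc x} _   = z<s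

  cyclicAbs : ℕ → ℕ
  cyclicAbs v = v ⊓ (Q ∸ v)

  cyclicAbs-neg : ∀ v → cyclicAbs (neg Q v) ≡ cyclicAbs v
  cyclicAbs-neg zero = refl
  cyclicAbs-neg (suc v) with ≤-total (suc v) Q
  ... | inj₁ sv≤Q = trans (cong ((Q ∸ suc v) ⊓_) (m∸[m∸n]≡n sv≤Q)) (⊓-comm (Q ∸ suc v) (suc v))
  ... | inj₂ Q≤v  rewrite m≤n⇒m∸n≡0 Q≤v = sym (⊓-zeroʳ (suc v))

  truncate : ℕ → ℕ
  truncate w with w <? q
  ... | yes _ = w
  ... | no  _ = 0

  truncate-< : ∀ {w} → w < q → truncate w ≡ w
  truncate-< {w} w<q with w <? q
  ... | yes _   = refl
  ... | no  w≮q = contradiction w<q w≮q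

  truncate-≥ : ∀ {w} → q ≤ w → truncate w ≡ 0
  truncate-≥ {w} q≤w with w <? q
  ... | yes w<q = contradiction q≤w (<⇒≱ w<q)
  ... | no  _   = refl

  -- The term of S that v lies over: cyclicAbs v is the distance from v to 0 in ℤ_Q, and the terms
  -- ±x with 0 < x < q give back x, while ±q and the replaced zeros give 0.
  carried : ℕ → ℕ
  carried v = truncate (cyclicAbs v)

  carried-neg : ∀ v → carried (neg Q v) ≡ carried v
  carried-neg v = cong truncate (cyclicAbs-neg v)

  carried-lift : ∀ {x} → x < q → carried (lift x) ≡ x
  carried-lift {zero} _ =
    trans (cong truncate (m≤n⇒m⊓n≡m (<⇒≤ q<Q∸q))) (truncate-≥ ≤-refl)
  carried-lift {suc x} x<q =
    trans (cong truncate (m≤n⇒m⊓n≡m 1+x≤Q∸[1+x])) (truncate-< x<q)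
    where
    1+x≤Q∸[1+x] : suc x ≤ Q ∸ suc x
    1+x≤Q∸[1+x] = ≤-trans (<⇒≤ (<-≤-trans x<q (<⇒≤ q<Q∸q))) (∸-monoʳ-≤ Q (<⇒≤ x<q))

  carried-large : ∀ {v} → q ≤ v → q ≤ Q ∸ v → carried v ≡ 0
  carried-large q≤v q≤Q∸v = truncate-≥ (⊓-glb q≤v q≤Q∸v)

  band : ℕ → Band
  band v with v ≤? q | v <? Q ∸ q
  ... | yes _ | _     = low
  ... | no  _ | yes _ = middle
  ... | no  _ | no  _ = high

  band-low : ∀ {v} → v ≤ q → band v ≡ low
  band-low {v} v≤q with v ≤? q
  ... | yes _   = refl
  ... | no  v≰q = contradiction v≤q v≰q

  band-middle : ∀ {v} → q < v → v < Q ∸ q → band v ≡ middle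
  band-middle {v} q<v v<Q∸q with v ≤? q | v <? Q ∸ q
  ... | yes v≤q | _       = contradiction v≤q (<⇒≱ q<v)
  ... | no  _   | yes _   = refl
  ... | no  _   | no  v≮ = contradiction v<Q∸q v≮

  band-high : ∀ {v} → q < v → Q ∸ q ≤ v → band v ≡ high
  band-high {v} q<v Q∸q≤v with v ≤? q | v <? Q ∸ q
  ... | yes v≤q | _       = contradiction v≤q (<⇒≱ q<v)
  ... | no  _   | yes v<  = contradiction Q∸q≤v (<⇒≱ v<)
  ... | no  _   | no  _   = refl

  data Shape (x : ℕ) : Band → ℕ → Set where
    low    : x < q → Shape x low (lift x)
    high   : x < q → Shape x high (Q ∸ lift x)
    middle : ∀ {v} → x ≡ 0 → q < v → v < Q ∸ q → Shape x middle v

  shape-neg : ∀ {x b v} → Shape x b v → Shape x (flipBand b) (neg Q v)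
  shape-neg (low x<q) = subst (Shape _ high) (sym (neg≡∸ (lift-positive x<q))) (high x<q)
  shape-neg {x} (high x<q) = subst (Shape x low) lift≡ (low x<q)
    where
    lift≡ : lift x ≡ neg Q (Q ∸ lift x)
    lift≡ = sym (trans (neg≡∸ (m<n⇒0<n∸m (≤-<-trans (lift-≤ x<q) q<Q)))
                       (m∸[m∸n]≡n (≤-trans (lift-≤ x<q) q≤Q)))
  shape-neg (middle x≡0 q<v v<Q∸q) = subst (Shape _ middle) (sym (neg≡∸ (≤-<-trans z≤n q<v)))
    (middle x≡0 (∸-flip-< q≤Q v<Q∸q) (∸-monoʳ-< q<v (≤-trans (<⇒≤ v<Q∸q) (m∸n≤m Q q))))

  shape-carried : ∀ {x b v} → Shape x b v → carried v ≡ x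
  shape-carried (low x<q)  = carried-lift x<q
  shape-carried (high x<q) =
    trans (cong carried (sym (neg≡∸ (lift-positive x<q)))) (trans (carried-neg (lift _)) (carried-lift x<q))
  shape-carried (middle refl q<v v<Q∸q) = carried-large (<⇒≤ q<v) (<⇒≤ (∸-flip-< q≤Q v<Q∸q))

  shape-band : ∀ {x b v} → Shape x b v → band v ≡ b
  shape-band (low x<q)  = band-low (lift-≤ x<q)
  shape-band {x} (high x<q) = band-high (<-≤-trans q<Q∸q Q∸q≤) Q∸q≤
    where
    Q∸q≤ : Q ∸ q ≤ Q ∸ lift x
    Q∸q≤ = ∸-monoʳ-≤ Q (lift-≤ x<q)
  shape-band (middle _ q<v v<Q∸q) = band-middle q<v v<Q∸q

  shape-positive : ∀ {x b v} → Shape x b v → 0 < v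
  shape-positive (low x<q)        = lift-positive x<q
  shape-positive (high x<q)       = m<n⇒0<n∸m (≤-<-trans (lift-≤ x<q) q<Q)
  shape-positive (middle _ q<v _) = ≤-<-trans z≤n q<v

  shape-<Q : ∀ {x b v} → Shape x b v → v < Q
  shape-<Q (low x<q)          = ≤-<-trans (lift-≤ x<q) q<Q
  shape-<Q (high x<q)         = ∸-monoʳ-< (lift-positive x<q) (≤-trans (lift-≤ x<q) q≤Q)
  shape-<Q (middle _ _ v<Q∸q) = <-≤-trans v<Q∸q (m∸n≤m Q q)

  shape-signed : ∀ {x} e → x < q → Shape x (if isEven e then low else high) (signed Q e (lift x))
  shape-signed e x<q with isEven e
  ... | true  = low x<q
  ... | false = shape-neg (low x<q)

  shape-filler : ∀ b → Shape 0 middle (if b then q + 1 else Q ∸ q ∸ 1)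
  shape-filler true  = middle refl (subst (q <_) (+-comm 1 q) ≤-refl) (subst (_< Q ∸ q) (+-comm 1 q) gap)
  shape-filler false = middle refl (m+n≤o⇒m≤o∸n (suc q) (subst (_≤ Q ∸ q) (+-comm 1 (suc q)) gap))
                                   (∸-monoʳ-< z<s (≤-trans (s≤s z≤n) q<Q∸q))

-- Recovering the quarter from two bands

-- The quarters s′, −s′, t, −t of the ring sequence of U.
data Block : Set where
  s⁺ s⁻ t⁺ t⁻ : Block

nextBlock : Block → Block
nextBlock s⁺ = s⁻
nextBlock s⁻ = t⁺
nextBlock t⁺ = t⁻
nextBlock t⁻ = s⁺

bandPattern : Block → Bool → Bool → Band
bandPattern s⁺ zero? _        = if zero? then middle else low
bandPattern s⁻ zero? positive = flipBand (bandPattern s⁺ zero? positive)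
bandPattern t⁺ _     positive = if positive then low else high
bandPattern t⁻ zero? positive = flipBand (bandPattern t⁺ zero? positive)

-- Inside an s-quarter the band is constant (low or high) apart from isolated middles, as consecutive
-- terms of S differ, while inside a t-quarter it alternates. At the end of a quarter the term of S
-- is non-zero with a positive lift (the exponent 2(m − 1) is even), which tells t⁻ from s⁺ and t⁺
-- from s⁻, and the next quarter starts with s₀ = 0, which tells the s-quarters from the t-quarters.
interiorBlock : Bool → Band → Band → Block
interiorBlock positive low  high = if positive then t⁺ else t⁻
interiorBlock positive high low  = if positive then t⁻ else t⁺
interiorBlock _        high _    = s⁻
interiorBlock _        _    high = s⁻
interiorBlock _        _    _    = s⁺

interiorBlock-pattern : ∀ β z z′ e → (z ≡ true → z′ ≢ true) →
                        interiorBlock e (bandPattern β z e) (bandPattern β z′ (not e)) ≡ β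
interiorBlock-pattern β  true  true  e     notBoth = contradiction refl (notBoth refl)
interiorBlock-pattern s⁺ true  false e     _       = refl
interiorBlock-pattern s⁺ false true  e     _       = refl
interiorBlock-pattern s⁺ false false e     _       = refl
interiorBlock-pattern s⁻ true  false e     _       = refl
interiorBlock-pattern s⁻ false true  e     _       = refl
interiorBlock-pattern s⁻ false false e     _       = refl
interiorBlock-pattern t⁺ z     z′    true  _       = refl
interiorBlock-pattern t⁺ z     z′    false _       = refl
interiorBlock-pattern t⁻ z     z′    true  _       = refl
interiorBlock-pattern t⁻ z     z′    false _       = refl

boundaryBlock : Band → Band → Block
boundaryBlock low  middle = s⁺
boundaryBlock low  _      = t⁺
boundaryBlock high middle = t⁻
boundaryBlock _    _      = s⁻

boundaryBlock-pattern : ∀ β e →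
                        boundaryBlock (bandPattern β false true) (bandPattern (nextBlock β) true e) ≡ β
boundaryBlock-pattern s⁺ e     = refl
boundaryBlock-pattern s⁻ true  = refl
boundaryBlock-pattern s⁻ false = refl
boundaryBlock-pattern t⁺ true  = refl
boundaryBlock-pattern t⁺ false = refl
boundaryBlock-pattern t⁻ e     = refl

-- The sequence U′

isZero-true : ∀ {x} → isZero x ≡ true → x ≡ 0
isZero-true {zero} _ = refl

isZero-false : ∀ {x} → x ≢ 0 → isZero x ≡ false
isZero-false {zero}  x≢0 = contradiction refl x≢0
isZero-false {suc x} _   = refl

isEven-suc : ∀ n → isEven (suc n) ≡ not (isEven n)
isEven-suc zero          = refl
isEven-suc (suc zero)    = refl
isEven-suc (suc (suc n)) = isEven-suc n

isEven-double : ∀ n → isEven (n + n) ≡ true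
isEven-double zero    = refl
isEven-double (suc n) = trans (cong isEven (cong suc (+-suc n n))) (isEven-double n)

module Quarters (q Q : ℕ) (s : List ℕ) .{{_ : NonZero (length s)}} where

  m : ℕ
  m = length s

  t : List ℕ
  t = applyUpTo (tTerm q Q m s) m

  U : List ℕ
  U = Useq q Q s

  N : ℕ
  N = length U

  0<m : 0 < m
  0<m = >-nonZero⁻¹ m

  pos : Block → ℕ → ℕ
  pos s⁺ i = i
  pos s⁻ i = m + i
  pos t⁺ i = m + (m + i)
  pos t⁻ i = m + (m + (m + i))

  entry : Block → ℕ → ℕ
  entry s⁺ i = nth s i
  entry s⁻ i = neg Q (nth s i)
  entry t⁺ i = tTerm q Q m s i
  entry t⁻ i = neg Q (tTerm q Q m s i)

  length-t : length t ≡ m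
  length-t = length-applyUpTo _ m

  N≡ : N ≡ m + (m + (m + m))
  N≡ = trans (length-++ s) (cong (m +_) (trans (length-++ (map (neg Q) s))
         (cong₂ _+_ (length-map _ s)
                    (trans (length-++ t) (cong₂ _+_ length-t (trans (length-map _ t) length-t))))))

  instance
    N-nonZero : NonZero N
    N-nonZero = >-nonZero (subst (0 <_) (sym N≡) (≤-trans 0<m (m≤m+n m _)))

  pos-< : ∀ β {i} → i < m → pos β i < N
  pos-< β {i} i<m = subst (pos β i <_) (sym N≡) (bound β)
    where
    bound : ∀ β → pos β i < m + (m + (m + m))
    bound s⁺ = ≤-trans i<m (m≤m+n m _)
    bound s⁻ = +-monoʳ-< m (≤-trans i<m (m≤m+n m _))
    bound t⁺ = +-monoʳ-< m (+-monoʳ-< m (≤-trans i<m (m≤m+n m _)))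
    bound t⁻ = +-monoʳ-< m (+-monoʳ-< m (+-monoʳ-< m i<m))

  nth-U : ∀ β {i} → i < m → nth U (pos β i) ≡ entry β i
  nth-U s⁺ i<m = nth-++ˡ s _ i<m
  nth-U s⁻ {i} i<m = begin
    nth U (m + i)                        ≡⟨ nth-++ʳ s _ i ⟩
    nth (map (neg Q) s ++ t ++ _) i      ≡⟨ nth-++ˡ (map (neg Q) s) _
                                                      (subst (i <_) (sym (length-map _ s)) i<m) ⟩
    nth (map (neg Q) s) i                ≡⟨ nth-map (neg Q) s i<m ⟩
    neg Q (nth s i)                      ∎
    where open ≡-Reasoning
  nth-U t⁺ {i} i<m = begin
    nth U (m + (m + i))                  ≡⟨ nth-++ʳ s _ (m + i) ⟩
    nth (map (neg Q) s ++ t ++ _) (m + i) ≡⟨ nth-++ʳ′ (map (neg Q) s) _ i (length-map _ s) ⟩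
    nth (t ++ map (neg Q) t) i           ≡⟨ nth-++ˡ t _ (subst (i <_) (sym length-t) i<m) ⟩
    nth t i                              ≡⟨ nth-applyUpTo _ m i<m ⟩
    tTerm q Q m s i                      ∎
    where open ≡-Reasoning
  nth-U t⁻ {i} i<m = begin
    nth U (m + (m + (m + i)))            ≡⟨ nth-++ʳ s _ (m + (m + i)) ⟩
    nth (map (neg Q) s ++ t ++ _) (m + (m + i))
                                         ≡⟨ nth-++ʳ′ (map (neg Q) s) _ (m + i) (length-map _ s) ⟩
    nth (t ++ map (neg Q) t) (m + i)     ≡⟨ nth-++ʳ′ t _ i length-t ⟩
    nth (map (neg Q) t) i                ≡⟨ nth-map (neg Q) t (subst (i <_) (sym length-t) i<m) ⟩
    neg Q (nth t i)                      ≡⟨ cong (neg Q) (nth-applyUpTo _ m i<m) ⟩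
    neg Q (tTerm q Q m s i)              ∎
    where open ≡-Reasoning

  term-U : ∀ β {i} → i < m → term U (pos β i) ≡ entry β i
  term-U β i<m = trans (term≡nth U (pos-< β i<m)) (nth-U β i<m)

  private
    split-< : ∀ {p k} → p < m + k → p < m ⊎ ∃ λ p′ → p′ < k × m + p′ ≡ p
    split-< {p} {k} p<m+k with p <? m
    ... | yes p<m = inj₁ p<m
    ... | no  p≮m =
      inj₂ (p ∸ m , +-cancelˡ-< m _ _ (subst (_< m + k) (sym m+[p∸m]≡p) p<m+k) , m+[p∸m]≡p)
      where
      m+[p∸m]≡p : m + (p ∸ m) ≡ p
      m+[p∸m]≡p = m+[n∸m]≡n (≮⇒≥ p≮m)

  pos-surjective : ∀ {p} → p < N → Σ Block λ β → ∃ λ i → i < m × pos β i ≡ p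
  pos-surjective p<N with split-< (subst (_ <_) N≡ p<N)
  ... | inj₁ p<m = s⁺ , _ , p<m , refl
  ... | inj₂ (p₁ , p₁< , refl) with split-< p₁<
  ...   | inj₁ p₁<m = s⁻ , p₁ , p₁<m , refl
  ...   | inj₂ (p₂ , p₂< , refl) with split-< p₂<
  ...     | inj₁ p₂<m = t⁺ , p₂ , p₂<m , refl
  ...     | inj₂ (p₃ , p₃<m , refl) = t⁻ , p₃ , p₃<m , refl

  data Next (β : Block) (i : ℕ) : Block → ℕ → Set where
    interior : suc i < m → Next β i β (suc i)
    boundary : suc i ≡ m → Next β i (nextBlock β) 0

  next : ∀ β {i} → i < m → ∃₂ (Next β i)
  next β {i} i<m with suc i <? m
  ... | yes si<m = β , suc i , interior si<m
  ... | no  si≮m = nextBlock β , 0 , boundary (≤-antisym i<m (≮⇒≥ si≮m))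

  Next-< : ∀ {β i β′ i′} → Next β i β′ i′ → i′ < m
  Next-< (interior si<m) = si<m
  Next-< (boundary _)    = 0<m

  pos-suc : ∀ β i → pos β (suc i) ≡ suc (pos β i)
  pos-suc s⁺ i = refl
  pos-suc s⁻ i = +-suc m i
  pos-suc t⁺ i = trans (cong (m +_) (+-suc m i)) (+-suc m _)
  pos-suc t⁻ i = trans (cong (m +_) (trans (cong (m +_) (+-suc m i)) (+-suc m _))) (+-suc m _)

  pos-end : ∀ β → pos β m % N ≡ pos (nextBlock β) 0
  pos-end s⁺ = trans (cong (_% N) (sym (+-identityʳ m))) (m<n⇒m%n≡m (pos-< s⁻ 0<m))
  pos-end s⁻ = trans (cong (λ k → (m + k) % N) (sym (+-identityʳ m))) (m<n⇒m%n≡m (pos-< t⁺ 0<m))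
  pos-end t⁺ =
    trans (cong (λ k → (m + (m + k)) % N) (sym (+-identityʳ m))) (m<n⇒m%n≡m (pos-< t⁻ 0<m))
  pos-end t⁻ = trans (cong (_% N) (sym N≡)) (n%n≡0 N)

  suc-pos-% : ∀ {β i β′ i′} → Next β i β′ i′ → suc (pos β i) % N ≡ pos β′ i′
  suc-pos-% {β} {i} (interior si<m) =
    trans (cong (_% N) (sym (pos-suc β i))) (m<n⇒m%n≡m (pos-< β si<m))
  suc-pos-% {β} {i} (boundary si≡m) =
    trans (cong (_% N) (trans (sym (pos-suc β i)) (cong (pos β) si≡m))) (pos-end β)

module Construction (q Q : ℕ) (gap : suc q < Q ∸ q) (s : List ℕ) .{{_ : NonZero (length s)}}
  (s-OS : OS q 2 s) (s₀≡0 : nth s 0 ≡ 0) (c : ℕ → Bool) where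

  open Decoding q Q gap public
  open Quarters q Q s public

  private
    s-over : Over q s
    s-over = proj₁ s-OS
    s-windowSeq : WindowSeq 2 s
    s-windowSeq = proj₁ (proj₂ s-OS)
    s-noReversal : Avoids 2 reverse s
    s-noReversal = proj₂ (proj₂ s-OS)

  filled : ℕ → ℕ
  filled = fill (term U) c (q + 1) (Q ∸ q ∸ 1)

  U′ : List ℕ
  U′ = replaceZeros q Q c U

  nth-s<q : ∀ {i} → i < m → nth s i < q
  nth-s<q = All-nth s-over

  tPositive : ℕ → Bool
  tPositive i = isEven (i + m ∸ 1)

  bandAt : Block → ℕ → Band
  bandAt β i = bandPattern β (isZero (nth s i)) (tPositive i)

  tTerm≡ : ∀ {i} → i < m → tTerm q Q m s i ≡ signed Q (i + m ∸ 1) (lift (nth s i))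
  tTerm≡ {i} i<m = trans (tTerm≡lift-term i) (cong (signed Q (i + m ∸ 1) ∘ lift) (term≡nth s i<m))
    where
    tTerm≡lift-term : ∀ i → tTerm q Q m s i ≡ signed Q (i + m ∸ 1) (lift (term s i))
    tTerm≡lift-term i with term s i
    ... | zero  = refl
    ... | suc _ = refl

  filled-zero : ∀ {p} → term U p ≡ 0 → filled p ≡ (if c p then q + 1 else Q ∸ q ∸ 1)
  filled-zero eq rewrite eq = refl

  filled-nonzero : ∀ {p} → term U p ≢ 0 → filled p ≡ term U p
  filled-nonzero {p} ≢0 with term U p
  ... | zero  = contradiction refl ≢0
  ... | suc _ = refl

  filled-shape : ∀ {p x b v} → term U p ≡ v → Shape x b v → Shape x b (filled p)
  filled-shape {p} eq shape = subst (Shape _ _) (sym (trans (filled-nonzero U≢0) eq)) shape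
    where
    U≢0 : term U p ≢ 0
    U≢0 U≡0 = <⇒≢ (shape-positive shape) (sym (trans (sym eq) U≡0))

  shape-filled : ∀ β {i} → i < m → Shape (nth s i) (bandAt β i) (filled (pos β i))
  shape-filled s⁺ {i} i<m with nth s i in sᵢ
  ... | zero  = subst (Shape 0 middle) (sym (filled-zero (trans (term-U s⁺ i<m) sᵢ))) (shape-filler (c i))
  ... | suc _ = filled-shape (trans (term-U s⁺ i<m) sᵢ) (low (subst (_< q) sᵢ (nth-s<q i<m)))
  shape-filled s⁻ {i} i<m with nth s i in sᵢ
  ... | zero  = subst (Shape 0 middle) (sym (filled-zero (trans (term-U s⁻ i<m) (cong (neg Q) sᵢ))))
                      (shape-filler (c (m + i)))
  ... | suc _ = filled-shape (trans (term-U s⁻ i<m) (cong (neg Q) sᵢ))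
                             (shape-neg (low (subst (_< q) sᵢ (nth-s<q i<m))))
  shape-filled t⁺ {i} i<m = filled-shape (trans (term-U t⁺ i<m) (tTerm≡ i<m))
                                         (shape-signed (i + m ∸ 1) (nth-s<q i<m))
  shape-filled t⁻ {i} i<m = filled-shape (trans (term-U t⁻ i<m) (cong (neg Q) (tTerm≡ i<m)))
                                         (shape-neg (shape-signed (i + m ∸ 1) (nth-s<q i<m)))

  term-U′ : ∀ p → term U′ p ≡ filled (p % N)
  term-U′ p = term-applyUpTo filled N p

  window-U′ : ∀ {β i β′ i′} → i < m → Next β i β′ i′ →
              window 2 U′ (pos β i) ≡ filled (pos β i) ∷ filled (pos β′ i′) ∷ []
  window-U′ {β} {i} i<m n = cong₂ (λ a b → a ∷ b ∷ [])
    (trans (term-U′ _) (cong filled (trans (cong (_% N) (+-identityʳ _)) (m<n⇒m%n≡m (pos-< β i<m)))))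
    (trans (term-U′ _) (cong filled (trans (cong (_% N) (+-comm _ 1)) (suc-pos-% n))))

  window-s : ∀ {β i β′ i′} → i < m → Next β i β′ i′ → window 2 s i ≡ nth s i ∷ nth s i′ ∷ []
  window-s {i = i} i<m n = cong₂ (λ a b → a ∷ b ∷ [])
    (trans (cong (term s) (+-identityʳ i)) (term≡nth s i<m)) (second n)
    where
    second : ∀ {β β′ i′} → Next β i β′ i′ → term s (i + 1) ≡ nth s i′
    second (interior si<m) = trans (cong (term s) (+-comm i 1)) (term≡nth s si<m)
    second (boundary si≡m) = trans (term-cong-% s (trans (cong (_% m) (trans (+-comm i 1) si≡m))
                                     (trans (n%n≡0 m) (sym (m<n⇒m%n≡m 0<m)))))
                                   (term≡nth s 0<m)

  carried-window : ∀ {β i β′ i′} → i < m → Next β i β′ i′ →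
                   map carried (window 2 U′ (pos β i)) ≡ window 2 s i
  carried-window {β} {β′ = β′} i<m n = begin
    map carried (window 2 U′ (pos β _))   ≡⟨ cong (map carried) (window-U′ i<m n) ⟩
    _ ∷ _ ∷ []                           ≡⟨ cong₂ (λ a b → a ∷ b ∷ [])
                                                   (shape-carried (shape-filled β i<m))
                                                   (shape-carried (shape-filled β′ (Next-< n))) ⟩
    nth s _ ∷ nth s _ ∷ []               ≡⟨ sym (window-s i<m n) ⟩
    window 2 s _                         ∎
    where open ≡-Reasoning

  band-window : ∀ {β i β′ i′} → i < m → Next β i β′ i′ →
                map band (window 2 U′ (pos β i)) ≡ bandAt β i ∷ bandAt β′ i′ ∷ []
  band-window {β} {β′ = β′} i<m n = trans (cong (map band) (window-U′ i<m n))
    (cong₂ (λ a b → a ∷ b ∷ []) (shape-band (shape-filled β i<m))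
                                (shape-band (shape-filled β′ (Next-< n))))

  s-adjacent-distinct : ∀ {β i β′ i′} → i < m → Next β i β′ i′ → nth s i ≢ nth s i′
  s-adjacent-distinct {i = i} i<m n sᵢ≡sᵢ′ = s-noReversal i i (begin
    window 2 s i            ≡⟨ window-s i<m n ⟩
    nth s i ∷ nth s _ ∷ []  ≡⟨ cong₂ (λ a b → a ∷ b ∷ []) sᵢ≡sᵢ′ (sym sᵢ≡sᵢ′) ⟩
    nth s _ ∷ nth s i ∷ []  ≡⟨ cong reverse (sym (window-s i<m n)) ⟩
    reverse (window 2 s i)  ∎)
    where open ≡-Reasoning

  tPositive-suc : ∀ i → tPositive (suc i) ≡ not (tPositive i)
  tPositive-suc i = trans (cong isEven (suc-pred′ (≤-trans 0<m (m≤n+m m i)))) (isEven-suc (i + m ∸ 1))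
    where
    suc-pred′ : ∀ {n} → 0 < n → n ≡ suc (n ∸ 1)
    suc-pred′ {suc n} _ = refl

  tPositive-last : ∀ {i} → suc i ≡ m → tPositive i ≡ true
  tPositive-last {i} si≡m = trans (cong (λ k → isEven (i + k ∸ 1)) (sym si≡m))
                                  (trans (cong (λ k → isEven (k ∸ 1)) (+-suc i i)) (isEven-double i))

  block-interior : ∀ β {i} → suc i < m →
                   interiorBlock (tPositive i) (bandAt β i) (bandAt β (suc i)) ≡ β
  block-interior β {i} si<m rewrite tPositive-suc i =
    interiorBlock-pattern β _ _ (tPositive i)
      (λ zᵢ zᵢ₊₁ → s-adjacent-distinct (<-trans (n<1+n i) si<m) (interior {β = β} si<m)
                     (trans (isZero-true zᵢ) (sym (isZero-true zᵢ₊₁))))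

  block-boundary : ∀ β {i} → suc i ≡ m → boundaryBlock (bandAt β i) (bandAt (nextBlock β) 0) ≡ β
  block-boundary β {i} si≡m
    rewrite isZero-false (λ sᵢ≡0 → s-adjacent-distinct (subst (i <_) si≡m (n<1+n i)) (boundary {β = β} si≡m)
                                                       (trans sᵢ≡0 (sym s₀≡0)))
          | tPositive-last si≡m | s₀≡0 = boundaryBlock-pattern β (tPositive 0)

  block-injective : ∀ {β β′ i β₁ i₁ β₁′ i₁′} → Next β i β₁ i₁ → Next β′ i β₁′ i₁′ →
                    bandAt β i ≡ bandAt β′ i → bandAt β₁ i₁ ≡ bandAt β₁′ i₁′ → β ≡ β′
  block-injective {β} {β′} {i} (interior si<m) (interior _) e e′ =
    trans (sym (block-interior β si<m))
          (trans (cong₂ (interiorBlock (tPositive i)) e e′) (block-interior β′ si<m))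
  block-injective {β} {β′} (boundary si≡m) (boundary _) e e′ =
    trans (sym (block-boundary β si≡m)) (trans (cong₂ boundaryBlock e e′) (block-boundary β′ si≡m))
  block-injective (interior si<m) (boundary si≡m) _ _ = contradiction si≡m (<⇒≢ si<m)
  block-injective (boundary si≡m) (interior si<m) _ _ = contradiction si≡m (<⇒≢ si<m)

  pos-window-injective : ∀ β {i} β′ {i′} → i < m → i′ < m →
                         window 2 U′ (pos β i) ≡ window 2 U′ (pos β′ i′) → pos β i ≡ pos β′ i′
  pos-window-injective β {i} β′ {i′} i<m i′<m e with next β i<m | next β′ i′<m
  ... | β₁ , i₁ , n | β₁′ , i₁′ , n′
    with windowSeq⇒injective-< {r = s} s-windowSeq i<m i′<m
           (trans (sym (carried-window i<m n)) (trans (cong (map carried) e) (carried-window i′<m n′)))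
  ... | refl =
    cong (λ β → pos β i) (block-injective n n′ (∷-injectiveˡ bands) (∷-injectiveˡ (∷-injectiveʳ bands)))
    where
    bands : bandAt β i ∷ bandAt β₁ i₁ ∷ [] ≡ bandAt β′ i ∷ bandAt β₁′ i₁′ ∷ []
    bands = trans (sym (band-window i<m n)) (trans (cong (map band) e) (band-window i′<m n′))

  pos-window-avoids : ∀ (g : List ℕ → List ℕ) → (∀ w → map carried (g w) ≡ reverse (map carried w)) →
                      ∀ β {i} β′ {i′} → i < m → i′ < m →
                      window 2 U′ (pos β i) ≢ g (window 2 U′ (pos β′ i′))
  pos-window-avoids g carried-g β {i} β′ {i′} i<m i′<m e with next β i<m | next β′ i′<m
  ... | _ , _ , n | _ , _ , n′ = s-noReversal i i′ (begin
    window 2 s i                                  ≡⟨ sym (carried-window i<m n) ⟩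
    map carried (window 2 U′ (pos β i))           ≡⟨ cong (map carried) e ⟩
    map carried (g (window 2 U′ (pos β′ i′)))     ≡⟨ carried-g _ ⟩
    reverse (map carried (window 2 U′ (pos β′ i′))) ≡⟨ cong reverse (carried-window i′<m n′) ⟩
    reverse (window 2 s i′)                       ∎)
    where open ≡-Reasoning

  length-U′ : length U′ ≡ N
  length-U′ = length-applyUpTo filled N

  instance
    U′-nonZero : NonZero (length U′)
    U′-nonZero = >-nonZero (subst (0 <_) (sym length-U′) (>-nonZero⁻¹ N))

  at-position : ∀ {P : ℕ → Set} → (∀ β {i} → i < m → P (pos β i)) → ∀ {p} → p < N → P p
  at-position P-pos p<N with pos-surjective p<N
  ... | β , i , i<m , refl = P-pos β i<m

  at-positions : ∀ {R : ℕ → ℕ → Set} → (∀ β {i} β′ {i′} → i < m → i′ < m → R (pos β i) (pos β′ i′)) →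
                 ∀ {k k′} → k < length U′ → k′ < length U′ → R k k′
  at-positions {R} R-pos {k} {k′} k< k′< =
    at-position {P = λ k → R k k′}
      (λ β {i} i<m → at-position {P = R (pos β i)} (λ β′ i′<m → R-pos β β′ i<m i′<m)
                                 (subst (k′ <_) length-U′ k′<))
      (subst (k <_) length-U′ k<)

  U′-bounded : All (λ v → 0 < v × v < Q) U′
  U′-bounded = applyUpTo⁺₁ filled N (at-position λ β i<m →
    let shape = shape-filled β i<m in shape-positive shape , shape-<Q shape)

  U′-injective : ∀ {k k′} → k < length U′ → k′ < length U′ → window 2 U′ k ≡ window 2 U′ k′ → k ≡ k′
  U′-injective =
    at-positions {R = λ k k′ → window 2 U′ k ≡ window 2 U′ k′ → k ≡ k′} pos-window-injective

  U′-avoids : ∀ (g : List ℕ → List ℕ) → (∀ w → map carried (g w) ≡ reverse (map carried w)) →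
              ∀ {k k′} → k < length U′ → k′ < length U′ → window 2 U′ k ≢ g (window 2 U′ k′)
  U′-avoids g carried-g =
    at-positions {R = λ k k′ → window 2 U′ k ≢ g (window 2 U′ k′)} (pos-window-avoids g carried-g)

  U′-SOS : SOS Q 2 U′
  U′-SOS = ( All.map proj₂ U′-bounded
           , injective-<⇒windowSeq U′ U′-injective
           , avoids-<⇒Avoids U′ {2} reverse (U′-avoids reverse (reverse-map carried)))
         , avoids-<⇒Avoids U′ {2} (map (neg Q) ∘ reverse) (U′-avoids (map (neg Q) ∘ reverse) carried-neg-reverse)
    where
    carried-neg-reverse : ∀ w → map carried (map (neg Q) (reverse w)) ≡ reverse (map carried w)
    carried-neg-reverse w =
      trans (sym (map-∘ (reverse w))) (trans (map-cong carried-neg (reverse w)) (reverse-map carried w))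

  term-U′-< : ∀ {p} → p < N → term U′ p ≡ filled p
  term-U′-< p<N = trans (term-U′ _) (cong filled (m<n⇒m%n≡m p<N))

  nth-U′ : ∀ {p} → p < N → nth U′ p ≡ filled p
  nth-U′ = nth-applyUpTo filled N

  filled-s : ∀ {i} → i < m → nth s i ≢ 0 → filled i ≡ nth s i
  filled-s i<m sᵢ≢0 = trans (filled-nonzero (λ U≡0 → sᵢ≢0 (trans (sym (term-U s⁺ i<m)) U≡0))) (term-U s⁺ i<m)

  filled-chosen : ∀ {i} → i < m → nth s i ≡ 0 → c i ≡ true → filled i ≡ q + 1
  filled-chosen i<m sᵢ≡0 cᵢ =
    trans (filled-zero (trans (term-U s⁺ i<m) sᵢ≡0)) (cong (if_then q + 1 else Q ∸ q ∸ 1) cᵢ)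

  Q∣sum-U : Q ∣ sum U
  Q∣sum-U = subst (Q ∣_) (sym sum-U) (∣m∣n⇒∣m+n (∣sum+sum-neg s s-≤Q) (∣sum+sum-neg t t-≤Q))
    where
    s-≤Q : All (_≤ Q) s
    s-≤Q = All.map (λ x<q → <⇒≤ (<-trans x<q q<Q)) s-over
    t-≤Q : All (_≤ Q) t
    t-≤Q = applyUpTo⁺₁ _ m λ {i} i<m →
      <⇒≤ (shape-<Q (subst (Shape _ _) (sym (tTerm≡ i<m)) (shape-signed (i + m ∸ 1) (nth-s<q i<m))))
    sum-U : sum U ≡ (sum s + sum (map (neg Q) s)) + (sum t + sum (map (neg Q) t))
    sum-U = trans (sum-++ s _) (trans (cong (sum s +_) (trans (sum-++ (map (neg Q) s) _)
              (cong (sum (map (neg Q) s) +_) (sum-++ t _)))) (sym (+-assoc (sum s) _ _)))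

  Q∣sum-U′ : countChoice c true U ≡ countChoice c false U → Q ∣ sum U′
  Q∣sum-U′ balanced = subst (Q ∣_) (sym sum-U′) (∣m∣n⇒∣m+n Q∣sum-U (m∣m*n k))
    where
    open ≡-Reasoning
    k : ℕ
    k = zerosChosen (term U) c false N
    fillers : q + 1 + (Q ∸ q ∸ 1) ≡ Q
    fillers = trans (+-comm (q + 1) _) (trans (cong (_+ (q + 1)) (∸-+-assoc Q q 1))
                (m∸n+n≡m (subst (_≤ Q) (+-comm 1 q) q<Q)))
    sum-U′ : sum U′ ≡ sum U + Q * k
    sum-U′ = begin
      sum U′
        ≡⟨ sum-fill (term U) c (q + 1) (Q ∸ q ∸ 1) N ⟩
      sum (applyUpTo (term U) N) + ((q + 1) * zerosChosen (term U) c true N + (Q ∸ q ∸ 1) * k)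
        ≡⟨ cong₂ (λ xs j → sum xs + ((q + 1) * j + (Q ∸ q ∸ 1) * k)) (applyUpTo-term U)
                 (trans (sym (countChoice≡zerosChosen c true U))
                        (trans balanced (countChoice≡zerosChosen c false U))) ⟩
      sum U + ((q + 1) * k + (Q ∸ q ∸ 1) * k)
        ≡⟨ cong (sum U +_) (trans (sym (*-distribʳ-+ k (q + 1) _)) (cong (_* k) fillers)) ⟩
      sum U + Q * k ∎

-- Deleting the first three terms

module Trimmed (q Q : ℕ) (gap : suc q < Q ∸ q) (1<q : 1 < q) (rest : List ℕ)
  (s-OS : OS q 2 (0 ∷ 1 ∷ (q ∸ 1) ∷ 0 ∷ rest)) (c : ℕ → Bool) (c₀ : c 0 ≡ true) (c₃ : c 3 ≡ true)
  where

  open Construction q Q gap (0 ∷ 1 ∷ (q ∸ 1) ∷ 0 ∷ rest) s-OS refl c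

  U** : List ℕ
  U** = drop 3 U′

  private
    1<m : 1 < m
    1<m = s≤s (s≤s z≤n)
    2<m : 2 < m
    2<m = s≤s (s≤s (s≤s z≤n))
    3<m : 3 < m
    3<m = s≤s (s≤s (s≤s (s≤s z≤n)))

    3<length-U′ : 3 < length U′
    3<length-U′ = subst (3 <_) (sym length-U′) (pos-< s⁺ 3<m)

    instance
      U**-nonZero : NonZero (length U**)
      U**-nonZero = >-nonZero (subst (0 <_) (sym (length-drop 3 U′)) (m<n⇒0<n∸m 3<length-U′))

  U′₃≡U′₀ : term U′ 3 ≡ term U′ 0
  U′₃≡U′₀ = trans (term-U′-< (pos-< s⁺ 3<m)) (trans (filled-chosen 3<m refl c₃)
              (sym (trans (term-U′-< (pos-< s⁺ 0<m)) (filled-chosen 0<m refl c₀))))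

  U**-good : Good 2 U**
  U**-good = All-positive⇒Good (drop⁺ 3 (All.map proj₁ U′-bounded))

  U**-SOS : SOS Q 2 U**
  U**-SOS = SOS-drop U′ 3<length-U′ U′₃≡U′₀ U′-SOS

  length-U** : ∀ {a} → 2 * m ≡ q * a → length U** ≡ 2 * q * a ∸ 3
  length-U** {a} 2m≡qa = trans (length-drop 3 U′) (cong (_∸ 3) (begin
    length U′             ≡⟨ trans length-U′ N≡ ⟩
    m + (m + (m + m))     ≡⟨ four-times m ⟩
    2 * (2 * m)           ≡⟨ cong (2 *_) 2m≡qa ⟩
    2 * (q * a)           ≡⟨ sym (*-assoc 2 q a) ⟩
    2 * q * a             ∎))
    where
    open ≡-Reasoning
    four-times : ∀ m → m + (m + (m + m)) ≡ 2 * (2 * m)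
    four-times = solve-∀

  Q∣weight+2q+1 : countChoice c true U ≡ countChoice c false U → Q ∣ weight U** + (2 * q + 1)
  Q∣weight+2q+1 balanced = subst (Q ∣_) (begin
    sum U′                                  ≡⟨ sum≡first-three+sum-drop U′ (<⇒≤ 3<length-U′) ⟩
    nth U′ 0 + (nth U′ 1 + (nth U′ 2 + sum U**))
      ≡⟨ cong₂ (λ a b → a + (b + (nth U′ 2 + sum U**)))
               (trans (nth-U′ (pos-< s⁺ 0<m)) (filled-chosen 0<m refl c₀))
               (trans (nth-U′ (pos-< s⁺ 1<m)) (filled-s 1<m λ ())) ⟩
    q + 1 + (1 + (nth U′ 2 + sum U**))
      ≡⟨ cong (λ a → q + 1 + (1 + (a + sum U**))) (trans (nth-U′ (pos-< s⁺ 2<m)) (filled-s 2<m q∸1≢0)) ⟩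
    q + 1 + (1 + (q ∸ 1 + sum U**))         ≡⟨ rearrange 1<q ⟩
    sum U** + (2 * q + 1)                   ∎) (Q∣sum-U′ balanced)
    where
    open ≡-Reasoning
    q∸1≢0 : q ∸ 1 ≢ 0
    q∸1≢0 = m<n⇒n≢0 (m<n⇒0<n∸m 1<q)
    rearrange : ∀ {q} → 1 < q → q + 1 + (1 + (q ∸ 1 + sum U**)) ≡ sum U** + (2 * q + 1)
    rearrange {suc p} _ = shuffle p (sum U**)
      where
      shuffle : ∀ p S → suc p + 1 + (1 + (p + S)) ≡ S + (2 * suc p + 1)
      shuffle = solve-∀

theorem4p9 : (q q' : ℕ) → 4 < q → (q' ≡ 2 * q + 2 ⊎ q' ≡ 2 * q + 3) →
    (s : List ℕ) → OS q 2 s →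
    (q % 2 ≡ 1 → 2 * length s ≡ q * (q ∸ 1)) →
    (q % 2 ≡ 0 → 2 * length s ≡ q * (q ∸ 2)) →
    (∃ λ rest → s ≡ 0 ∷ 1 ∷ (q ∸ 1) ∷ 0 ∷ rest) →
    (c : ℕ → Bool) → ValidChoice c (Useq q q' s) →
    Good 2 (drop 3 (replaceZeros q q' c (Useq q q' s)))
    × SOS q' 2 (drop 3 (replaceZeros q q' c (Useq q q' s)))
    × (q % 2 ≡ 1 → length (drop 3 (replaceZeros q q' c (Useq q q' s))) ≡ 2 * q * (q ∸ 1) ∸ 3)
    × (q % 2 ≡ 0 → length (drop 3 (replaceZeros q q' c (Useq q q' s))) ≡ 2 * q * (q ∸ 2) ∸ 3)
    × Coprime (weightMod q' (drop 3 (replaceZeros q q' c (Useq q q' s)))) q'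
theorem4p9 q q' 4<q q'≡ s s-OS odd-length even-length (rest , refl) c (balanced , c₀ , c₃) =
  U**-good , U**-SOS , length-U** ∘ odd-length , length-U** ∘ even-length ,
  coprime-residue {q} q'≡ (Q∣weight+2q+1 balanced)
  where open Trimmed q q' (gap-from q'≡) (<-trans (s≤s (s≤s z≤n)) 4<q) rest s-OS c c₀ c₃
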